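{- Up to the equivalence $T\sim aTb$ ($a,b\in\mathrm{GL}_3(\mathbf{F}_2)$), there is exactly one transversal to $\mathrm{PG}(8)$, and it is orientable: $|\mathrm{T}(\mathrm{PG}(8))|=1=|\mathrm{T}^+(\mathrm{PG}(8))|$. Moreover, if $T$ is a transversal to $\mathrm{PG}(8)$, then $\mathrm{GL}_3(\mathbf{F}_2)\cap\mathrm{GL}_3(\mathbf{F}_2)^T$ is the normalizer in $\mathrm{GL}_3(\mathbf{F}_2)$ of a Sylow $7$-subgroup of $\mathrm{GL}_3(\mathbf{F}_2)$.
   Context: Let $\mathbf{F}_8$ be the field with $8$ elements, viewed as $\mathbf{F}_2^3$, and $V=\mathbf{F}_8^\times$. $\mathrm{PG}(8)$ is the Steiner triple system on $V$ with triples $\{a,b,c\}$, $a\neq b$, $a+b+c=0$; its Steiner quasigroup is $\mu(a,b)=a+b$ ($a\neq b$), $\mu(a,a)=a$. Its automorphism group $\Sigma(\mu)$ is $\mathrm{GL}_3(\mathbf{F}_2)$ acting on $V$. Permutations act on the right; for $T\in\Sigma(V)$ (permutations of $V$), $\mu^T(x,y)=\mu(x^{T^{ -1}},y^{T^{ -1}})^T$ and $\Sigma(\mu)^T=T^{ -1}\Sigma(\mu)T$. $T$ is (orientably) transversal to $\mu$ if the triple systems $S(\mu)$ and $S(\mu^T)=S(\mu)^T$ are disjoint and their union is an (orientable) combinatorial surface. $\mathrm{T}^{(+)}(\mu)$ is the set of double cosets $\Sigma(\mu)T\Sigma(\mu)\in\Sigma(\mu)\backslash\Sigma(V)/\Sigma(\mu)$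 with $T$ (orientably) transversal to $\mu$; this property depends only on the double coset. -}

module Defs where

open import Data.Bool using (Bool; true; false; _xor_; if_then_else_; T)
open import Data.Product using (Σ; ∃; _×_; _,_)
open import Data.Sum using (_⊎_)
open import Data.Nat using (ℕ; _^_; _*_)
open import Data.Nat.Divisibility using (_∣_)
open import Data.Fin using (Fin; zero; suc; _≟_)
open import Data.Fin.Patterns
open import Data.Fin.Permutation using (Permutation′; _⟨$⟩ʳ_; _⟨$⟩ˡ_; _∘ₚ_; flip; id)
open import Data.List using (List; length)
open import Data.List.Relation.Unary.All using (All)
open import Data.List.Relation.Unary.Any using (Any)
open import Data.List.Relation.Unary.AllPairs using (AllPairs)
open import Relation.Binary.PropositionalEquality using (_≡_; _≢_)
open import Relation.Binary.Construct.Closure.ReflexiveTransitive using (Star)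
open import Relation.Nullary using (¬_; does)
open import Function.Bundles using (_⇔_)

F₂³ : Set
F₂³ = Bool × Bool × Bool

_⊕_ : F₂³ → F₂³ → F₂³
(a , b , c) ⊕ (a' , b' , c') = (a xor a') , (b xor b') , (c xor c')

-- V = F₈ˣ, the 7 nonzero vectors of F₂³.  Index i : Fin 7 stands for the
-- vector whose binary expansion (bit2,bit1,bit0) is i+1.
V : Set
V = Fin 7

vec : V → F₂³
vec 0F = false , false , true
vec 1F = false , true  , false
vec 2F = false , true  , true
vec 3F = true  , false , false
vec 4F = true  , false , true
vec 5F = true  , true  , false
vec 6F = true  , true  , true

-- inverse of vec on nonzero vectors (the zero vector is never used below,
-- since it is only applied to a sum of two distinct nonzero vectors)
unvec : F₂³ → V
unvec (false , false , false) = 0F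
unvec (false , false , true ) = 0F
unvec (false , true  , false) = 1F
unvec (false , true  , true ) = 2F
unvec (true  , false , false) = 3F
unvec (true  , false , true ) = 4F
unvec (true  , true  , false) = 5F
unvec (true  , true  , true ) = 6F

BinOp : Set
BinOp = V → V → V

μ : BinOp
μ a b = if does (a ≟ b) then a else unvec (vec a ⊕ vec b)

Perm : Set
Perm = Permutation′ 7

infixl 8 _^ₚ_
_^ₚ_ : V → Perm → V
x ^ₚ T = T ⟨$⟩ʳ x

_^ₚ⁻¹_ : V → Perm → V
x ^ₚ⁻¹ T = T ⟨$⟩ˡ x

_≈ₚ_ : Perm → Perm → Set
S ≈ₚ T = ∀ x → x ^ₚ S ≡ x ^ₚ T

-- Note: S ∘ₚ T means "first S, then T", i.e. x ^ (S ∘ₚ T) = (x ^ S) ^ T,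
-- matching the right-action convention ST.

_^μ_ : BinOp → Perm → BinOp
(m ^μ T) x y = m (x ^ₚ⁻¹ T) (y ^ₚ⁻¹ T) ^ₚ T

Aut : BinOp → Perm → Set
Aut m g = ∀ x y → m x y ^ₚ g ≡ m (x ^ₚ g) (y ^ₚ g)

AutConj : BinOp → Perm → Perm → Set
AutConj m T g = ∃ λ a → Aut m a × (g ≈ₚ (flip T ∘ₚ a ∘ₚ T))

-- A set of triangles on V is given by a predicate on ordered triples
-- (for the triple systems considered it is invariant under permuting x,y,z).
Triangles : Set₁
Triangles = V → V → V → Set

S : BinOp → Triangles
S m x y z = x ≢ y × m x y ≡ z

_∪_ : Triangles → Triangles → Triangles
(F ∪ F') x y z = F x y z ⊎ F' x y z

Disjoint : Triangles → Triangles → Set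
Disjoint F F' = ∀ x y z → ¬ (F x y z × F' x y z)

ExactlyTwo : (V → Set) → Set
ExactlyTwo P = ∃ λ z₁ → ∃ λ z₂ → z₁ ≢ z₂ × P z₁ × P z₂ ×
               (∀ z → P z → z ≡ z₁ ⊎ z ≡ z₂)

Link : Triangles → V → V → V → Set
Link F v a b = F v a b

-- Closed combinatorial surface with vertex set V:
--  * every edge {x,y} (x ≠ y) lies in exactly two triangles, so every
--    vertex link is 2-regular, i.e. a disjoint union of cycles;
--  * every vertex link is connected (so it is a single cycle).
CombinatorialSurface : Triangles → Set
CombinatorialSurface F =
  (∀ x y → x ≢ y → ExactlyTwo (F x y)) ×
  (∀ v a b → a ≢ v → b ≢ v → Star (Link F v) a b)

-- An orientation: a choice of one of the two cyclic orders of each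
-- triangle, such that each directed edge x→y occurs in at most one
-- oriented triangle (i.e. adjacent triangles induce opposite orientations
-- on their common edge).
Orientation : Triangles → (V → V → V → Bool) → Set
Orientation F O =
  (∀ x y z → T (O x y z) → F x y z) ×
  (∀ x y z → T (O x y z) → T (O y z x)) ×
  (∀ x y z → F x y z → T (O x y z) ⊎ T (O x z y)) ×
  (∀ x y z → ¬ (T (O x y z) × T (O x z y))) ×
  (∀ x y z z' → T (O x y z) → T (O x y z') → z ≡ z')

Orientable : Triangles → Set
Orientable F = ∃ λ O → Orientation F O

Transversal : BinOp → Perm → Set
Transversal m T = Disjoint (S m) (S (m ^μ T)) × CombinatorialSurface (S m ∪ S (m ^μ T))

OrientablyTransversal : BinOp → Perm → Set
OrientablyTransversal m T = Transversal m T × Orientable (S m ∪ S (m ^μ T))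

SameDoubleCoset : BinOp → Perm → Perm → Set
SameDoubleCoset m T T' = ∃ λ a → ∃ λ b → Aut m a × Aut m b × (T' ≈ₚ (a ∘ₚ T ∘ₚ b))

Subset : Set₁
Subset = Perm → Set

IsSubgroupOf : Subset → Subset → Set
IsSubgroupOf G H =
  (∀ g → H g → G g) ×
  (∀ g h → g ≈ₚ h → H g → H h) ×
  H id ×
  (∀ g h → H g → H h → H (g ∘ₚ h)) ×
  (∀ g → H g → H (flip g))

HasCard : Subset → ℕ → Set
HasCard H n = Σ (List Perm) λ l →
  length l ≡ n × AllPairs (λ g h → ¬ (g ≈ₚ h)) l × All H l ×
  (∀ g → H g → Any (λ h → g ≈ₚ h) l)

IsSylow : ℕ → Subset → Subset → Set
IsSylow p G H = IsSubgroupOf G H × ∃ λ k → ∃ λ m →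
  HasCard H (p ^ k) × HasCard G (p ^ k * m) × ¬ (p ∣ m)

Normalizer : Subset → Subset → Subset
Normalizer G P g = G g × (∀ h → P h ⇔ P (flip g ∘ₚ h ∘ₚ g))

-- A transversal T must map no line of PG(8) onto a line.  The element of Σ = GL₃(F₂)
-- sending the images of 0F, 1F, 2F (which span F₂³) back to the basis 0F, 1F, 3F
-- normalises T to fix 0F and 1F and send 2F to 3F; an exhaustive search over the four
-- remaining values leaves eight permutations, each of the form a R c with a, c ∈ Σ.
-- So every transversal lies in the double coset Σ R Σ.  Along T' = a T b the surface
-- S(μ) ∪ S(μ^T') is the image of S(μ) ∪ S(μ^T) under b and Σ ∩ Σ^T' = b⁻¹ (Σ ∩ Σ^T) b,
-- so everything reduces to R: its surface is the orientable 7-vertex torus, and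
-- Σ ∩ Σ^R is the normalizer of the Sylow 7-subgroup generated by a 7-cycle c,
-- checked element by element on the 168 automorphisms.
module Submission where

open import Defs
open import Data.Bool using (Bool)
open import Data.Fin using (Fin; _≟_; toℕ; punchOut)
open import Data.Fin.Patterns
open import Data.Fin.Permutation using (Permutation′; permutation; inverseˡ; inverseʳ; _∘ₚ_; flip; id)
open import Data.Fin.Properties using (all?; any?; punchOut-injective; injective⇒≤)
open import Data.List using (List; []; _∷_; map; mapMaybe; foldr; concatMap; cartesianProduct; allFin)
open import Data.List.Properties using (length-map)
open import Data.List.Membership.Propositional using (_∈_)
open import Data.List.Membership.Propositional.Properties using (∈-cartesianProduct⁺; ∈-allFin)
import Data.List.Relation.Unary.All as All
import Data.List.Relation.Unary.All.Properties as All
import Data.List.Relation.Unary.Any as Any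
import Data.List.Relation.Unary.Any.Properties as Any
import Data.List.Relation.Unary.AllPairs as AllPairs
import Data.List.Relation.Unary.AllPairs.Properties as AllPairs
open import Data.Maybe using (Maybe; just; nothing; _<∣>_; _>>=_; Is-just; to-witness)
import Data.Maybe as Maybe
import Data.Maybe.Relation.Unary.Any as MaybeAny
open import Data.Nat using (ℕ; zero; suc)
open import Data.Nat.Divisibility using (_∣?_)
open import Data.Nat.Properties using (1+n≰n)
open import Data.Product using (∃; _×_; _,_; proj₁; proj₂)
open import Data.Product.Function.NonDependent.Propositional using (_×-⇔_)
open import Data.Product.Properties using (≡-dec)
open import Data.Sum using (inj₁; inj₂; [_,_])
import Data.Sum as Sum
open import Data.Unit using (⊤; tt)
open import Data.Vec using (Vec; []; _∷_; lookup)
open import Function using (_∘_)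
open import Function.Bundles using (_⇔_; mk⇔; Equivalence)
open import Function.Definitions using (Injective)
import Function.Properties.Equivalence as ⇔
open import Relation.Binary.Construct.Closure.ReflexiveTransitive using (Star; ε; _◅_)
open import Relation.Binary.PropositionalEquality
  using (_≡_; _≢_; refl; sym; trans; cong; cong₂; module ≡-Reasoning)
open import Relation.Nullary using (¬_; Dec; does; yes; no; ¬?; contradiction)
open import Relation.Nullary.Decidable
  using (True; toWitness; from-yes; from-no; map′; dec⇒maybe; _×-dec_; _⊎-dec_; _→-dec_; T?)

open Equivalence using (to; from)
open ≡-Reasoning

injective⇒surjective : ∀ {n} {f : Fin n → Fin n} → Injective _≡_ _≡_ f →
                       ∀ y → ∃ λ x → f x ≡ y
injective⇒surjective {suc n} {f} f-inj y with any? (λ x → f x ≟ y)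
... | yes hit  = hit
... | no  miss = contradiction (injective⇒≤ punched-injective) 1+n≰n
  where
  y≢f : ∀ x → y ≢ f x
  y≢f x y≡fx = miss (x , sym y≡fx)
  punched-injective : Injective _≡_ _≡_ (λ x → punchOut (y≢f x))
  punched-injective = f-inj ∘ punchOut-injective (y≢f _) (y≢f _)

injective⇒permutation : ∀ {n} {f : Fin n → Fin n} → Injective _≡_ _≡_ f → Permutation′ n
injective⇒permutation {f = f} f-inj =
  permutation f (proj₁ ∘ surj) (proj₂ ∘ surj) (λ x → f-inj (proj₂ (surj (f x))))
  where
  surj : ∀ y → ∃ λ x → f x ≡ y
  surj = injective⇒surjective f-inj

^ₚ-^ₚ⁻¹ : ∀ (T : Perm) x → (x ^ₚ T) ^ₚ⁻¹ T ≡ x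
^ₚ-^ₚ⁻¹ T x = inverseˡ T

^ₚ⁻¹-^ₚ : ∀ (T : Perm) x → (x ^ₚ⁻¹ T) ^ₚ T ≡ x
^ₚ⁻¹-^ₚ T x = inverseʳ T

^ₚ-injective : ∀ (T : Perm) {x y} → x ^ₚ T ≡ y ^ₚ T → x ≡ y
^ₚ-injective T {x} {y} eq = begin
  x                ≡⟨ ^ₚ-^ₚ⁻¹ T x ⟨
  (x ^ₚ T) ^ₚ⁻¹ T  ≡⟨ cong (_^ₚ⁻¹ T) eq ⟩
  (y ^ₚ T) ^ₚ⁻¹ T  ≡⟨ ^ₚ-^ₚ⁻¹ T y ⟩
  y                ∎

∘ₚ-cong : ∀ S S' T T' → S ≈ₚ S' → T ≈ₚ T' → (S ∘ₚ T) ≈ₚ (S' ∘ₚ T')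
∘ₚ-cong S S' T T' S≈S' T≈T' x = trans (cong (_^ₚ T) (S≈S' x)) (T≈T' (x ^ₚ S'))

flip-cong : ∀ S T → S ≈ₚ T → flip S ≈ₚ flip T
flip-cong S T S≈T x = begin
  x ^ₚ⁻¹ S                  ≡⟨ ^ₚ-^ₚ⁻¹ T _ ⟨
  ((x ^ₚ⁻¹ S) ^ₚ T) ^ₚ⁻¹ T  ≡⟨ cong (_^ₚ⁻¹ T) (S≈T _) ⟨
  ((x ^ₚ⁻¹ S) ^ₚ S) ^ₚ⁻¹ T  ≡⟨ cong (_^ₚ⁻¹ T) (^ₚ⁻¹-^ₚ S x) ⟩
  x ^ₚ⁻¹ T                  ∎

-- conj g h is g⁻¹ h g in the right-action notation of the paper.
conj : Perm → Perm → Perm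
conj g h = flip g ∘ₚ h ∘ₚ g

conj-congˡ : ∀ g g' h → g ≈ₚ g' → conj g h ≈ₚ conj g' h
conj-congˡ g g' h g≈g' x =
  trans (cong (λ y → (y ^ₚ h) ^ₚ g) (flip-cong g g' g≈g' x)) (g≈g' _)

conj-congʳ : ∀ g h h' → h ≈ₚ h' → conj g h ≈ₚ conj g h'
conj-congʳ g h h' h≈h' x = cong (_^ₚ g) (h≈h' (x ^ₚ⁻¹ g))

conj-cancelˡ : ∀ g h → conj (flip g) (conj g h) ≈ₚ h
conj-cancelˡ g h x = begin
  ((((x ^ₚ g) ^ₚ⁻¹ g) ^ₚ h) ^ₚ g) ^ₚ⁻¹ g  ≡⟨ ^ₚ-^ₚ⁻¹ g _ ⟩
  ((x ^ₚ g) ^ₚ⁻¹ g) ^ₚ h                 ≡⟨ cong (_^ₚ h) (^ₚ-^ₚ⁻¹ g x) ⟩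
  x ^ₚ h                                 ∎

conj-cancelʳ : ∀ g h → conj g (conj (flip g) h) ≈ₚ h
conj-cancelʳ g h x = begin
  ((((x ^ₚ⁻¹ g) ^ₚ g) ^ₚ h) ^ₚ⁻¹ g) ^ₚ g  ≡⟨ ^ₚ⁻¹-^ₚ g _ ⟩
  ((x ^ₚ⁻¹ g) ^ₚ g) ^ₚ h                 ≡⟨ cong (_^ₚ h) (^ₚ⁻¹-^ₚ g x) ⟩
  x ^ₚ h                                 ∎

conj-∘ₚ : ∀ g h k → conj g (h ∘ₚ k) ≈ₚ (conj g h ∘ₚ conj g k)
conj-∘ₚ g h k x = cong (λ y → (y ^ₚ k) ^ₚ g) (sym (^ₚ-^ₚ⁻¹ g _))

infixl 10 _^ᵖ_
_^ᵖ_ : Perm → ℕ → Perm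
g ^ᵖ zero  = id
g ^ᵖ suc k = g ^ᵖ k ∘ₚ g

conj-^ᵖ : ∀ g h k → conj g (h ^ᵖ k) ≈ₚ (conj g h ^ᵖ k)
conj-^ᵖ g h zero    x = ^ₚ⁻¹-^ₚ g x
conj-^ᵖ g h (suc k) x =
  trans (conj-∘ₚ g (h ^ᵖ k) h x) (cong (λ y → ((y ^ₚ⁻¹ g) ^ₚ h) ^ₚ g) (conj-^ᵖ g h k x))

conj≈⇔ : ∀ g h h' → conj g h ≈ₚ h' ⇔ (h ∘ₚ g) ≈ₚ (g ∘ₚ h')
conj≈⇔ g h h' = mk⇔
  (λ gh≈h' x → trans (cong (λ y → (y ^ₚ h) ^ₚ g) (sym (^ₚ-^ₚ⁻¹ g x))) (gh≈h' (x ^ₚ g)))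
  (λ hg≈gh' x → trans (hg≈gh' (x ^ₚ⁻¹ g)) (cong (_^ₚ h') (^ₚ⁻¹-^ₚ g x)))

conj⁻¹≈⇔ : ∀ g h h' → conj (flip g) h ≈ₚ h' ⇔ (g ∘ₚ h) ≈ₚ (h' ∘ₚ g)
conj⁻¹≈⇔ g h h' = mk⇔
  (λ gh≈h' x → trans (sym (^ₚ⁻¹-^ₚ g _)) (cong (_^ₚ g) (gh≈h' x)))
  (λ gh≈h'g x → trans (cong (_^ₚ⁻¹ g) (gh≈h'g x)) (^ₚ-^ₚ⁻¹ g _))

Sym : Subset
Sym _ = ⊤

module Subgroup {G H : Subset} (H≤G : IsSubgroupOf G H) where

  ⊆G : ∀ g → H g → G g
  ⊆G = proj₁ H≤G

  resp : ∀ g h → g ≈ₚ h → H g → H h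
  resp = proj₁ (proj₂ H≤G)

  id∈ : H id
  id∈ = proj₁ (proj₂ (proj₂ H≤G))

  ∘∈ : ∀ g h → H g → H h → H (g ∘ₚ h)
  ∘∈ = proj₁ (proj₂ (proj₂ (proj₂ H≤G)))

  flip∈ : ∀ g → H g → H (flip g)
  flip∈ = proj₂ (proj₂ (proj₂ (proj₂ H≤G)))

  ^ᵖ∈ : ∀ g k → H g → H (g ^ᵖ k)
  ^ᵖ∈ g zero    g∈ = id∈
  ^ᵖ∈ g (suc k) g∈ = ∘∈ (g ^ᵖ k) g (^ᵖ∈ g k g∈) g∈

  conj∈⇔ : ∀ g h → H g → H h ⇔ H (conj g h)
  conj∈⇔ g h g∈ = mk⇔
    (λ h∈ → ∘∈ (flip g) (h ∘ₚ g) (flip∈ g g∈) (∘∈ h g h∈ g∈))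
    (λ gh∈ → resp _ h (conj-cancelˡ g h)
               (∘∈ g (conj g h ∘ₚ flip g) g∈ (∘∈ (conj g h) (flip g) gh∈ (flip∈ g g∈))))

module _ {m : BinOp} where

  aut-resp : ∀ g h → g ≈ₚ h → Aut m g → Aut m h
  aut-resp g h g≈h g-aut x y = begin
    m x y ^ₚ h           ≡⟨ g≈h (m x y) ⟨
    m x y ^ₚ g           ≡⟨ g-aut x y ⟩
    m (x ^ₚ g) (y ^ₚ g)  ≡⟨ cong₂ m (g≈h x) (g≈h y) ⟩
    m (x ^ₚ h) (y ^ₚ h)  ∎

  aut-∘ₚ : ∀ g h → Aut m g → Aut m h → Aut m (g ∘ₚ h)
  aut-∘ₚ g h g-aut h-aut x y = trans (cong (_^ₚ h) (g-aut x y)) (h-aut (x ^ₚ g) (y ^ₚ g))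

  aut-flip : ∀ g → Aut m g → Aut m (flip g)
  aut-flip g g-aut x y = ^ₚ-injective g (begin
    (m x y ^ₚ⁻¹ g) ^ₚ g                    ≡⟨ ^ₚ⁻¹-^ₚ g _ ⟩
    m x y                                  ≡⟨ cong₂ m (^ₚ⁻¹-^ₚ g x) (^ₚ⁻¹-^ₚ g y) ⟨
    m ((x ^ₚ⁻¹ g) ^ₚ g) ((y ^ₚ⁻¹ g) ^ₚ g)  ≡⟨ g-aut _ _ ⟨
    m (x ^ₚ⁻¹ g) (y ^ₚ⁻¹ g) ^ₚ g           ∎)

  aut-⇔ : ∀ g h → g ≈ₚ h → Aut m g ⇔ Aut m h
  aut-⇔ g h g≈h = mk⇔ (aut-resp g h g≈h) (aut-resp h g (λ x → sym (g≈h x)))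

  aut-isSubgroup : IsSubgroupOf Sym (Aut m)
  aut-isSubgroup = (λ _ _ → tt) , aut-resp , (λ _ _ → refl) , aut-∘ₚ , aut-flip

-- P ^ˢ b is the conjugate subgroup b⁻¹ P b.
infixl 8 _^ˢ_
_^ˢ_ : Subset → Perm → Subset
(P ^ˢ b) h = P (conj (flip b) h)

module _ {G : Subset} (G-group : IsSubgroupOf Sym G) where

  open Subgroup G-group

  normalizer-conj : ∀ {P} → (∀ g h → g ≈ₚ h → P g → P h) → ∀ b → G b → ∀ g →
                    Normalizer G P (conj (flip b) g) ⇔ Normalizer G (P ^ˢ b) g
  normalizer-conj {P} P-resp b b∈ g =
    ⇔.sym (conj∈⇔ (flip b) g (flip∈ b b∈)) ×-⇔
    mk⇔ (λ normalizes h →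
          ⇔.trans (normalizes (conj (flip b) h))
                  (P-⇔ (conj g' (conj (flip b) h)) (conj (flip b) (conj g h)) (λ x → sym (key h x))))
        (λ normalizes h → let h' = conj (flip b) (conj b h) in
          ⇔.trans (P-⇔ h h' (λ x → sym (conj-cancelˡ b h x)))
          (⇔.trans (normalizes (conj b h))
          (⇔.trans (P-⇔ (conj (flip b) (conj g (conj b h))) (conj g' h') (key (conj b h)))
                   (P-⇔ (conj g' h') (conj g' h) (conj-congʳ g' h' h (conj-cancelˡ b h))))))
    where
    g' : Perm
    g' = conj (flip b) g
    P-⇔ : ∀ h h' → h ≈ₚ h' → P h ⇔ P h'
    P-⇔ h h' h≈h' = mk⇔ (P-resp h h' h≈h') (P-resp h' h (λ x → sym (h≈h' x)))
    key : ∀ h → conj (flip b) (conj g h) ≈ₚ conj g' (conj (flip b) h)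
    key h x = sym (begin
      ((((((((x ^ₚ b) ^ₚ⁻¹ g) ^ₚ⁻¹ b) ^ₚ b) ^ₚ h) ^ₚ⁻¹ b) ^ₚ b) ^ₚ g) ^ₚ⁻¹ b
        ≡⟨ cong (λ w → (w ^ₚ g) ^ₚ⁻¹ b) (^ₚ⁻¹-^ₚ b _) ⟩
      ((((((x ^ₚ b) ^ₚ⁻¹ g) ^ₚ⁻¹ b) ^ₚ b) ^ₚ h) ^ₚ g) ^ₚ⁻¹ b
        ≡⟨ cong (λ w → ((w ^ₚ h) ^ₚ g) ^ₚ⁻¹ b) (^ₚ⁻¹-^ₚ b _) ⟩
      ((((x ^ₚ b) ^ₚ⁻¹ g) ^ₚ h) ^ₚ g) ^ₚ⁻¹ b
        ∎)

  isSubgroup-conj : ∀ {P} b → G b → IsSubgroupOf G P → IsSubgroupOf G (P ^ˢ b)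
  isSubgroup-conj {P} b b∈ P≤G =
    (λ h h∈ → from (conj∈⇔ (flip b) h (flip∈ b b∈)) (P.⊆G _ h∈)) ,
    (λ g h g≈h → P.resp _ _ (conj-congʳ (flip b) g h g≈h)) ,
    P.resp id _ (λ x → sym (^ₚ-^ₚ⁻¹ b x)) P.id∈ ,
    (λ g h g∈ h∈ → P.resp _ _ (λ x → sym (conj-∘ₚ (flip b) g h x)) (P.∘∈ _ _ g∈ h∈)) ,
    (λ g g∈ → P.flip∈ _ g∈)
    where module P = Subgroup P≤G

hasCard-conj : ∀ {P n} → (∀ g h → g ≈ₚ h → P g → P h) → ∀ b →
               HasCard P n → HasCard (P ^ˢ b) n
hasCard-conj {P} P-resp b (l , length≡n , distinct , all∈ , complete) =
  map (conj b) l , trans (length-map (conj b) l) length≡n ,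
  AllPairs.map⁺ (AllPairs.map (λ {g} {h} → conj-distinct g h) distinct) ,
  All.map⁺ (All.map (λ {g} → P-resp g _ (λ x → sym (conj-cancelˡ b g x))) all∈) ,
  λ h h∈ → Any.map⁺ (Any.map (λ {g} b⁻¹hb≈g x →
    trans (sym (conj-cancelʳ b h x)) (conj-congʳ b (conj (flip b) h) g b⁻¹hb≈g x)) (complete _ h∈))
  where
  conj-distinct : ∀ g h → ¬ g ≈ₚ h → ¬ conj b g ≈ₚ conj b h
  conj-distinct g h g≉h bgb≈bhb = g≉h λ x → begin
    x ^ₚ g                         ≡⟨ conj-cancelˡ b g x ⟨
    x ^ₚ conj (flip b) (conj b g)  ≡⟨ conj-congʳ (flip b) (conj b g) (conj b h) bgb≈bhb x ⟩
    x ^ₚ conj (flip b) (conj b h)  ≡⟨ conj-cancelˡ b h x ⟩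
    x ^ₚ h                         ∎

isSylow-conj : ∀ {G P p} → IsSubgroupOf Sym G → ∀ b → G b →
               IsSylow p G P → IsSylow p G (P ^ˢ b)
isSylow-conj G-group b b∈ (P≤G , k , m , P-card , G-card , p∤m) =
  isSubgroup-conj G-group b b∈ P≤G , k , m ,
  hasCard-conj (Subgroup.resp P≤G) b P-card , G-card , p∤m

hasCard-∀ : ∀ {G n} (Q : Subset) → (∀ g h → g ≈ₚ h → Q h → Q g) → (card : HasCard G n) →
            All.All Q (proj₁ card) → ∀ g → G g → Q g
hasCard-∀ Q Q-resp (l , _ , _ , _ , complete) all-Q g g∈ =
  let (Qh , g≈h) = All.lookupAny all-Q (complete g g∈) in Q-resp g _ g≈h Qh

-- The powers g⁰, …, gⁿ⁻¹: the cyclic group ⟨g⟩ when g has order n.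
Powers : Perm → ℕ → Subset
Powers g n h = ∃ λ (k : Fin n) → h ≈ₚ (g ^ᵖ toℕ k)

powers-resp : ∀ g n h h' → h ≈ₚ h' → Powers g n h → Powers g n h'
powers-resp g n h h' h≈h' (k , h≈gᵏ) = k , λ x → trans (sym (h≈h' x)) (h≈gᵏ x)

normalizer-powers⇔ : ∀ {G c n} → IsSubgroupOf G (Powers c n) → Powers c n c → ∀ g →
  (∀ h → Powers c n h ⇔ Powers c n (conj g h)) ⇔
  (Powers c n (conj g c) × Powers c n (conj (flip g) c))
normalizer-powers⇔ {c = c} {n} P≤G c∈ g = mk⇔
  (λ normalizes → to (normalizes c) c∈ ,
     from (normalizes (conj (flip g) c))
          (P.resp c (conj g (conj (flip g) c)) (λ x → sym (conj-cancelʳ g c x)) c∈))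
  (λ (gc∈ , g⁻¹c∈) h → mk⇔
    (λ (k , h≈cᵏ) → P.resp (conj g c ^ᵖ toℕ k) (conj g h)
       (λ x → sym (trans (conj-congʳ g h (c ^ᵖ toℕ k) h≈cᵏ x) (conj-^ᵖ g c (toℕ k) x)))
       (P.^ᵖ∈ _ (toℕ k) gc∈))
    (λ (k , gh≈cᵏ) → P.resp (conj (flip g) c ^ᵖ toℕ k) h
       (λ x → sym (begin
          x ^ₚ h
            ≡⟨ conj-cancelˡ g h x ⟨
          x ^ₚ conj (flip g) (conj g h)
            ≡⟨ conj-congʳ (flip g) (conj g h) (c ^ᵖ toℕ k) gh≈cᵏ x ⟩
          x ^ₚ conj (flip g) (c ^ᵖ toℕ k)
            ≡⟨ conj-^ᵖ (flip g) c (toℕ k) x ⟩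
          x ^ₚ (conj (flip g) c ^ᵖ toℕ k)
            ∎))
       (P.^ᵖ∈ _ (toℕ k) g⁻¹c∈)))
  where module P = Subgroup P≤G

infix 4 _≗₂_
_≗₂_ : BinOp → BinOp → Set
m ≗₂ m' = ∀ x y → m x y ≡ m' x y

^μ-cong : ∀ {m m'} T → m ≗₂ m' → m ^μ T ≗₂ m' ^μ T
^μ-cong T m≗m' x y = cong (_^ₚ T) (m≗m' _ _)

^μ-congʳ : ∀ m S T → S ≈ₚ T → m ^μ S ≗₂ m ^μ T
^μ-congʳ m S T S≈T x y =
  trans (S≈T _) (cong (_^ₚ T) (cong₂ m (flip-cong S T S≈T x) (flip-cong S T S≈T y)))

^μ-aut : ∀ {m} a → Aut m a → m ^μ a ≗₂ m
^μ-aut {m} a a-aut x y = trans (a-aut _ _) (cong₂ m (^ₚ⁻¹-^ₚ a x) (^ₚ⁻¹-^ₚ a y))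

^μ-doubleCoset : ∀ {m} a b T T' → Aut m a → T' ≈ₚ (a ∘ₚ T ∘ₚ b) →
                 m ^μ T' ≗₂ (m ^μ T) ^μ b
^μ-doubleCoset {m} a b T T' a-aut T'≈aTb x y =
  trans (^μ-congʳ m T' (a ∘ₚ T ∘ₚ b) T'≈aTb x y) (^μ-cong b (^μ-cong T (^μ-aut a a-aut)) x y)

sameDoubleCoset-sym : ∀ {m T T'} → SameDoubleCoset m T T' → SameDoubleCoset m T' T
sameDoubleCoset-sym {T = T} {T'} (a , b , a-aut , b-aut , T'≈aTb) =
  flip a , flip b , aut-flip a a-aut , aut-flip b b-aut , λ x → sym (begin
    ((x ^ₚ⁻¹ a) ^ₚ T') ^ₚ⁻¹ b                 ≡⟨ cong (_^ₚ⁻¹ b) (T'≈aTb _) ⟩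
    ((((x ^ₚ⁻¹ a) ^ₚ a) ^ₚ T) ^ₚ b) ^ₚ⁻¹ b    ≡⟨ ^ₚ-^ₚ⁻¹ b _ ⟩
    ((x ^ₚ⁻¹ a) ^ₚ a) ^ₚ T                    ≡⟨ cong (_^ₚ T) (^ₚ⁻¹-^ₚ a x) ⟩
    x ^ₚ T                                    ∎)

sameDoubleCoset-trans : ∀ {m T T' T''} → SameDoubleCoset m T T' → SameDoubleCoset m T' T'' →
                        SameDoubleCoset m T T''
sameDoubleCoset-trans (a , b , a-aut , b-aut , T'≈aTb) (a' , b' , a'-aut , b'-aut , T''≈a'T'b') =
  a' ∘ₚ a , b ∘ₚ b' , aut-∘ₚ a' a a'-aut a-aut , aut-∘ₚ b b' b-aut b'-aut ,
  λ x → trans (T''≈a'T'b' x) (cong (_^ₚ b') (T'≈aTb _))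

autConj⇔aut : ∀ m T g → AutConj m T g ⇔ Aut m (conj (flip T) g)
autConj⇔aut m T g = mk⇔
  (λ (a , a-aut , g≈T⁻¹aT) → aut-resp a (conj (flip T) g)
     (λ x → sym (trans (conj-congʳ (flip T) g (conj T a) g≈T⁻¹aT x) (conj-cancelˡ T a x))) a-aut)
  (λ TgT⁻¹-aut → conj (flip T) g , TgT⁻¹-aut , λ x → sym (conj-cancelʳ T g x))

autConj-doubleCoset : ∀ {m} a b R T → Aut m a → Aut m b → T ≈ₚ (a ∘ₚ R ∘ₚ b) → ∀ g →
                      (Aut m g × AutConj m T g) ⇔
                      (Aut m (conj (flip b) g) × AutConj m R (conj (flip b) g))
autConj-doubleCoset {m} a b R T a-aut b-aut T≈aRb g =
  conj∈⇔ (flip b) g (aut-flip b b-aut) ×-⇔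
  ⇔.trans (autConj⇔aut m T g)
  (⇔.trans (aut-⇔ (conj (flip T) g) (conj (flip a) (conj (flip R) g'))
                  (conj-congˡ (flip T) (flip (a ∘ₚ R ∘ₚ b)) g (flip-cong T (a ∘ₚ R ∘ₚ b) T≈aRb)))
  (⇔.trans (⇔.sym (conj∈⇔ (flip a) (conj (flip R) g') (aut-flip a a-aut)))
           (⇔.sym (autConj⇔aut m R g'))))
  where
  open Subgroup (aut-isSubgroup {m})
  g' : Perm
  g' = conj (flip b) g

infix 4 _≐_
_≐_ : Triangles → Triangles → Set
F ≐ G = ∀ x y z → F x y z ⇔ G x y z

≐-trans : ∀ {F G H} → F ≐ G → G ≐ H → F ≐ H
≐-trans F≐G G≐H x y z = ⇔.trans (F≐G x y z) (G≐H x y z)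

∪-cong : ∀ {F F' G G'} → F ≐ F' → G ≐ G' → (F ∪ G) ≐ (F' ∪ G')
∪-cong F≐F' G≐G' x y z = mk⇔ (Sum.map (to (F≐F' x y z)) (to (G≐G' x y z)))
                             (Sum.map (from (F≐F' x y z)) (from (G≐G' x y z)))

infixl 8 _⟪_⟫
_⟪_⟫ : Triangles → Perm → Triangles
(F ⟪ b ⟫) x y z = F (x ^ₚ⁻¹ b) (y ^ₚ⁻¹ b) (z ^ₚ⁻¹ b)

S-cong : ∀ {m m'} → m ≗₂ m' → S m ≐ S m'
S-cong m≗m' x y z = mk⇔ (λ (x≢y , eq) → x≢y , trans (sym (m≗m' x y)) eq)
                        (λ (x≢y , eq) → x≢y , trans (m≗m' x y) eq)

S-^μ : ∀ m b → S (m ^μ b) ≐ S m ⟪ b ⟫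
S-^μ m b x y z = mk⇔
  (λ (x≢y , eq) → x≢y ∘ ^ₚ-injective (flip b) ,
                  trans (sym (^ₚ-^ₚ⁻¹ b _)) (cong (_^ₚ⁻¹ b) eq))
  (λ (x≢y , eq) → x≢y ∘ cong (_^ₚ⁻¹ b) ,
                  trans (cong (_^ₚ b) eq) (^ₚ⁻¹-^ₚ b z))

orientation-≐ : ∀ {F G O} → F ≐ G → Orientation G O → Orientation F O
orientation-≐ F≐G (O⊆G , rotate , cover , antisymmetric , functional) =
  (λ x y z o → from (F≐G x y z) (O⊆G x y z o)) , rotate ,
  (λ x y z f → cover x y z (to (F≐G x y z) f)) , antisymmetric , functional

orientation-⟪⟫ : ∀ {F O} b → Orientation F O →
                 Orientation (F ⟪ b ⟫) (λ x y z → O (x ^ₚ⁻¹ b) (y ^ₚ⁻¹ b) (z ^ₚ⁻¹ b))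
orientation-⟪⟫ b (O⊆F , rotate , cover , antisymmetric , functional) =
  (λ _ _ _ → O⊆F _ _ _) , (λ _ _ _ → rotate _ _ _) , (λ _ _ _ → cover _ _ _) ,
  (λ _ _ _ → antisymmetric _ _ _) ,
  (λ _ _ _ _ o o' → ^ₚ-injective (flip b) (functional _ _ _ _ o o'))

orientable-doubleCoset : ∀ {m} a b T T' → Aut m a → Aut m b → T' ≈ₚ (a ∘ₚ T ∘ₚ b) →
                         Orientable (S m ∪ S (m ^μ T)) → Orientable (S m ∪ S (m ^μ T'))
orientable-doubleCoset {m} a b T T' a-aut b-aut T'≈aTb (O , O-orientation) =
  _ , orientation-≐ surface≐ (orientation-⟪⟫ b O-orientation)
  where
  surface≐ : (S m ∪ S (m ^μ T')) ≐ (S m ∪ S (m ^μ T)) ⟪ b ⟫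
  surface≐ = ∪-cong {S m} {S m ⟪ b ⟫}
    (≐-trans {S m} {S (m ^μ b)} (S-cong (λ x y → sym (^μ-aut b b-aut x y))) (S-^μ m b))
    (≐-trans {S (m ^μ T')} {S ((m ^μ T) ^μ b)} (S-cong (^μ-doubleCoset a b T T' a-aut T'≈aTb))
                                                (S-^μ (m ^μ T) b))

disjoint⇒exactlyTwo : ∀ {m m'} → Disjoint (S m) (S m') →
                      ∀ x y → x ≢ y → ExactlyTwo ((S m ∪ S m') x y)
disjoint⇒exactlyTwo {m} {m'} disjoint x y x≢y =
  m x y , m' x y , (λ eq → disjoint x y _ ((x≢y , refl) , (x≢y , sym eq))) ,
  inj₁ (x≢y , refl) , inj₂ (x≢y , refl) ,
  λ z → [ (λ (_ , eq) → inj₁ (sym eq)) , (λ (_ , eq) → inj₂ (sym eq)) ]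

NoLineToLine : BinOp → (V → V) → Set
NoLineToLine m t = ∀ x y → x ≢ y → t (m x y) ≢ m (t x) (t y)

disjoint⇔noLineToLine : ∀ m T → Disjoint (S m) (S (m ^μ T)) ⇔ NoLineToLine m (_^ₚ T)
disjoint⇔noLineToLine m T = mk⇔
  (λ disjoint x y x≢y eq → disjoint (x ^ₚ T) (y ^ₚ T) _
     ( (x≢y ∘ ^ₚ-injective T , sym eq)
     , (x≢y ∘ ^ₚ-injective T , cong (_^ₚ T) (cong₂ m (^ₚ-^ₚ⁻¹ T x) (^ₚ-^ₚ⁻¹ T y)))))
  (λ noLine x y z ((x≢y , eq) , (_ , eq')) →
     noLine (x ^ₚ⁻¹ T) (y ^ₚ⁻¹ T) (x≢y ∘ ^ₚ-injective (flip T))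
       (trans eq' (trans (sym eq) (sym (cong₂ m (^ₚ⁻¹-^ₚ T x) (^ₚ⁻¹-^ₚ T y))))))

noLineToLine-resp : ∀ {m t t'} → (∀ x → t x ≡ t' x) → NoLineToLine m t → NoLineToLine m t'
noLineToLine-resp {m} t≗t' noLine x y x≢y eq =
  noLine x y x≢y (trans (t≗t' _) (trans eq (sym (cong₂ m (t≗t' x) (t≗t' y)))))

noLineToLine-aut : ∀ {m t} b → Aut m b → NoLineToLine m t → NoLineToLine m (λ x → t x ^ₚ b)
noLineToLine-aut b b-aut noLine x y x≢y eq =
  noLine x y x≢y (^ₚ-injective b (trans eq (sym (b-aut _ _))))

injective? : ∀ {n} (f : V → Fin n) → Dec (Injective _≡_ _≡_ f)
injective? f = map′ (λ inj {x} {y} → inj x y) (λ inj x y → inj)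
  (all? λ x → all? λ y → (f x ≟ f y) →-dec (x ≟ y))

aut? : ∀ m g → Dec (Aut m g)
aut? m g = all? λ x → all? λ y → m x y ^ₚ g ≟ m (x ^ₚ g) (y ^ₚ g)

_≈ₚ?_ : ∀ g h → Dec (g ≈ₚ h)
g ≈ₚ? h = all? λ x → x ^ₚ g ≟ x ^ₚ h

noLineToLine? : ∀ m t → Dec (NoLineToLine m t)
noLineToLine? m t = all? λ x → all? λ y → ¬? (x ≟ y) →-dec ¬? (t (m x y) ≟ m (t x) (t y))

∪S? : ∀ m m' x y z → Dec ((S m ∪ S m') x y z)
∪S? m m' x y z = (¬? (x ≟ y) ×-dec m x y ≟ z) ⊎-dec (¬? (x ≟ y) ×-dec m' x y ≟ z)

orientation? : ∀ F → (∀ x y z → Dec (F x y z)) → ∀ O → Dec (Orientation F O)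
orientation? F F? O =
  (all? λ x → all? λ y → all? λ z → T? (O x y z) →-dec F? x y z) ×-dec
  (all? λ x → all? λ y → all? λ z → T? (O x y z) →-dec T? (O y z x)) ×-dec
  (all? λ x → all? λ y → all? λ z → F? x y z →-dec (T? (O x y z) ⊎-dec T? (O x z y))) ×-dec
  (all? λ x → all? λ y → all? λ z → ¬? (T? (O x y z) ×-dec T? (O x z y))) ×-dec
  (all? λ x → all? λ y → all? λ z → all? λ z' →
     T? (O x y z) →-dec T? (O x y z') →-dec z ≟ z')

linkPath : ∀ F → (∀ x y z → Dec (F x y z)) → ℕ → ∀ v a b → Maybe (Star (Link F v) a b)
linkPath F F? n v a b with a ≟ b
linkPath F F? n       v a b | yes refl = just ε
linkPath F F? zero    v a b | no _     = nothing
linkPath F F? (suc n) v a b | no _     = foldr _<∣>_ nothing (map step (allFin 7))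
  where
  step : V → Maybe (Star (Link F v) a b)
  step c = dec⇒maybe (F? v a c) >>= λ edge → Maybe.map (edge ◅_) (linkPath F F? n v c b)

_⇔-dec_ : ∀ {A B : Set} → Dec A → Dec B → Dec (A ⇔ B)
a? ⇔-dec b? = map′ (λ (f , g) → mk⇔ f g) (λ e → to e , from e)
                   ((a? →-dec b?) ×-dec (b? →-dec a?))

-- Instances of Any.map⁺, Any.mapMaybe⁺ and All.map⁺ for an abstract list, so that applying them
-- to the concrete lists below does not make the unifier evaluate those lists.
any-map⁺ : ∀ {A B : Set} (f : A → B) (P : B → Set) {x} xs →
           x ∈ xs → P (f x) → Any.Any P (map f xs)
any-map⁺ f P xs x∈xs Pfx = Any.map⁺ (Any.map (λ { refl → Pfx }) x∈xs)

any-mapMaybe⁺ : ∀ {A B : Set} (f : A → Maybe B) (P : B → Set) {x} xs →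
                x ∈ xs → MaybeAny.Any P (f x) → Any.Any P (mapMaybe f xs)
any-mapMaybe⁺ f P xs x∈xs Pfx = Any.mapMaybe⁺ f xs (Any.map⁺ (Any.map (λ { refl → Pfx }) x∈xs))

all-map⁺ : ∀ {A B : Set} (f : A → B) (P : B → Set) xs → (∀ x → P (f x)) → All.All P (map f xs)
all-map⁺ f P xs Pf = All.map⁺ (All.universal Pf xs)

-- Σ = GL₃(F₂): the automorphisms of μ are the linear maps of F₂³

-- The images of the basis vectors 001, 010, 100, that is of 0F, 1F, 3F.
Frame : Set
Frame = V × V × V

_≟³_ : (e e' : V × V × V) → Dec (e ≡ e')
_≟³_ = ≡-dec _≟_ (≡-dec _≟_ _≟_)

linear : Frame → V → V
linear (a , b , d) 0F = a
linear (a , b , d) 1F = b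
linear (a , b , d) 2F = μ a b
linear (a , b , d) 3F = d
linear (a , b , d) 4F = μ a d
linear (a , b , d) 5F = μ b d
linear (a , b , d) 6F = μ (μ a b) d

frameOf : Perm → Frame
frameOf g = 0F ^ₚ g , 1F ^ₚ g , 3F ^ₚ g

frameOf-cong : ∀ g h → g ≈ₚ h → frameOf g ≡ frameOf h
frameOf-cong g h g≈h = cong₂ _,_ (g≈h 0F) (cong₂ _,_ (g≈h 1F) (g≈h 3F))

aut⇒linear : ∀ g → Aut μ g → ∀ x → x ^ₚ g ≡ linear (frameOf g) x
aut⇒linear g g-aut 0F = refl
aut⇒linear g g-aut 1F = refl
aut⇒linear g g-aut 2F = g-aut 0F 1F
aut⇒linear g g-aut 3F = refl
aut⇒linear g g-aut 4F = g-aut 0F 3F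
aut⇒linear g g-aut 5F = g-aut 1F 3F
aut⇒linear g g-aut 6F = trans (g-aut 2F 3F) (cong (λ z → μ z (3F ^ₚ g)) (g-aut 0F 1F))

aut⇒linear-injective : ∀ g → Aut μ g → Injective _≡_ _≡_ (linear (frameOf g))
aut⇒linear-injective g g-aut {x} {y} eq =
  ^ₚ-injective g (trans (aut⇒linear g g-aut x) (trans eq (sym (aut⇒linear g g-aut y))))

element : ∀ e → Injective _≡_ _≡_ (linear e) → Perm
element e = injective⇒permutation

⟦_⟧ : ∀ e → {True (injective? (linear e))} → Perm
⟦ e ⟧ {inj} = element e (toWitness inj)

fromTable : (v : Vec V 7) → {True (injective? (lookup v))} → Perm
fromTable v {inj} = injective⇒permutation (toWitness inj)

-- The finite checks, and the concrete permutations R and c below, are opaque: letting the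
-- unifier unfold them is prohibitively slow.  Only the checks themselves unfold R and c.
opaque
  linear-aut : ∀ e (inj : Injective _≡_ _≡_ (linear e)) → Aut μ (element e inj)
  linear-aut (a , b , d) = from-yes (all? λ a → all? λ b → all? λ d →
    injective? (linear (a , b , d)) →-dec
    (all? λ x → all? λ y →
       linear (a , b , d) (μ x y) ≟ μ (linear (a , b , d) x) (linear (a , b , d) y))) a b d

  independent⇒injective : ∀ x y z → x ≢ y → z ≢ x → z ≢ y → z ≢ μ x y →
                          Injective _≡_ _≡_ (linear (x , y , z))
  independent⇒injective = from-yes (all? λ x → all? λ y → all? λ z →
    ¬? (x ≟ y) →-dec ¬? (z ≟ x) →-dec ¬? (z ≟ y) →-dec ¬? (z ≟ μ x y) →-dec
    injective? (linear (x , y , z)))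

toAutomorphism : Frame → Maybe Perm
toAutomorphism e with injective? (linear e)
... | yes inj = just (element e inj)
... | no  _   = nothing

toAutomorphism-complete : ∀ e → Injective _≡_ _≡_ (linear e) →
                          MaybeAny.Any (λ h → ∀ x → x ^ₚ h ≡ linear e x) (toAutomorphism e)
toAutomorphism-complete e inj with injective? (linear e)
... | yes _   = MaybeAny.just (λ x → refl)
... | no ¬inj = contradiction (λ {x} {y} → inj {x} {y}) ¬inj

frames : List Frame
frames = cartesianProduct (allFin 7) (cartesianProduct (allFin 7) (allFin 7))

∈-frames : ∀ e → e ∈ frames
∈-frames (a , b , d) =
  ∈-cartesianProduct⁺ (∈-allFin a) (∈-cartesianProduct⁺ (∈-allFin b) (∈-allFin d))

automorphisms : List Perm
automorphisms = mapMaybe toAutomorphism frames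

opaque
  automorphisms-aut : All.All (Aut μ) automorphisms
  automorphisms-aut = from-yes (All.all? (aut? μ) automorphisms)

  automorphisms-distinct : AllPairs.AllPairs (λ g h → frameOf g ≢ frameOf h) automorphisms
  automorphisms-distinct =
    from-yes (AllPairs.allPairs? (λ g h → ¬? (frameOf g ≟³ frameOf h)) automorphisms)

aut∈automorphisms : ∀ g → Aut μ g → Any.Any (g ≈ₚ_) automorphisms
aut∈automorphisms g g-aut = any-mapMaybe⁺ toAutomorphism (g ≈ₚ_) frames (∈-frames (frameOf g))
  (MaybeAny.map (λ {h} h≗linear x → trans (aut⇒linear g g-aut x) (sym (h≗linear x)))
                (toAutomorphism-complete (frameOf g) (aut⇒linear-injective g g-aut)))

aut-card : HasCard (Aut μ) 168
aut-card = automorphisms , refl ,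
  AllPairs.map (λ {g} {h} frames≢ g≈h → frames≢ (frameOf-cong g h g≈h)) automorphisms-distinct ,
  automorphisms-aut , aut∈automorphisms

opaque
  R : Perm
  R = fromTable (0F ∷ 1F ∷ 3F ∷ 2F ∷ 5F ∷ 6F ∷ 4F ∷ [])

normalised : V → V → V → V → V → V
normalised x₃ x₄ x₅ x₆ = lookup (0F ∷ 1F ∷ 3F ∷ x₃ ∷ x₄ ∷ x₅ ∷ x₆ ∷ [])

-- The eight normalised permutations mapping no line to a line are a R c for these pairs (a , c).
doubleCosetWitnesses : List (Perm × Perm)
doubleCosetWitnesses =
  (⟦ 0F , 1F , 3F ⟧ , ⟦ 0F , 1F , 3F ⟧) ∷ (⟦ 0F , 1F , 4F ⟧ , ⟦ 0F , 1F , 3F ⟧) ∷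
  (⟦ 0F , 1F , 5F ⟧ , ⟦ 0F , 1F , 3F ⟧) ∷ (⟦ 0F , 1F , 6F ⟧ , ⟦ 0F , 1F , 3F ⟧) ∷
  (⟦ 1F , 0F , 3F ⟧ , ⟦ 1F , 0F , 3F ⟧) ∷ (⟦ 1F , 0F , 4F ⟧ , ⟦ 1F , 0F , 3F ⟧) ∷
  (⟦ 1F , 0F , 5F ⟧ , ⟦ 1F , 0F , 3F ⟧) ∷ (⟦ 1F , 0F , 6F ⟧ , ⟦ 1F , 0F , 3F ⟧) ∷ []

opaque
  unfolding R

  doubleCosetWitnesses-aut : All.All (λ (a , c) → Aut μ a × Aut μ c) doubleCosetWitnesses
  doubleCosetWitnesses-aut =
    from-yes (All.all? (λ (a , c) → aut? μ a ×-dec aut? μ c) doubleCosetWitnesses)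

  normalised-classification : ∀ x₃ x₄ x₅ x₆ → let s = normalised x₃ x₄ x₅ x₆ in
    Injective _≡_ _≡_ s → NoLineToLine μ s →
    Any.Any (λ (a , c) → ∀ x → s x ≡ x ^ₚ (a ∘ₚ R ∘ₚ c)) doubleCosetWitnesses
  normalised-classification = from-yes (all? λ x₃ → all? λ x₄ → all? λ x₅ → all? λ x₆ →
    let s = normalised x₃ x₄ x₅ x₆ in
    injective? s →-dec noLineToLine? μ s →-dec
    Any.any? (λ (a , c) → all? λ x → s x ≟ x ^ₚ (a ∘ₚ R ∘ₚ c)) doubleCosetWitnesses)

normalised-sameDoubleCoset : ∀ s → NoLineToLine μ (_^ₚ s) →
  0F ^ₚ s ≡ 0F → 1F ^ₚ s ≡ 1F → 2F ^ₚ s ≡ 3F → SameDoubleCoset μ R s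
normalised-sameDoubleCoset s noLine s₀ s₁ s₂ =
  let ((a-aut , c-aut) , v≗aRc) = All.lookupAny doubleCosetWitnesses-aut hit
  in proj₁ (Any.lookup hit) , proj₂ (Any.lookup hit) , a-aut , c-aut ,
     λ x → trans (s≗v x) (v≗aRc x)
  where
  v : V → V
  v = normalised (3F ^ₚ s) (4F ^ₚ s) (5F ^ₚ s) (6F ^ₚ s)
  s≗v : ∀ x → x ^ₚ s ≡ v x
  s≗v 0F = s₀
  s≗v 1F = s₁
  s≗v 2F = s₂
  s≗v 3F = refl
  s≗v 4F = refl
  s≗v 5F = refl
  s≗v 6F = refl
  hit : Any.Any (λ (a , c) → ∀ x → v x ≡ x ^ₚ (a ∘ₚ R ∘ₚ c)) doubleCosetWitnesses
  hit = normalised-classification _ _ _ _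
          (λ {x} {y} eq → ^ₚ-injective s (trans (s≗v x) (trans eq (sym (s≗v y)))))
          (noLineToLine-resp s≗v noLine)

-- 0F ^ T, 1F ^ T, 2F ^ T span F₂³ because {0F , 1F , 2F} is a line; f ∈ Σ sends 0F, 1F, 3F to them.
noLineToLine⇒sameDoubleCoset : ∀ T → NoLineToLine μ (_^ₚ T) → SameDoubleCoset μ R T
noLineToLine⇒sameDoubleCoset T noLine =
  sameDoubleCoset-trans {μ} {R} {T ∘ₚ flip f} {T}
    (normalised-sameDoubleCoset (T ∘ₚ flip f)
      (noLineToLine-aut {μ} {_^ₚ T} (flip f) (aut-flip f f-aut) noLine)
      (^ₚ-^ₚ⁻¹ f 0F) (^ₚ-^ₚ⁻¹ f 1F) (^ₚ-^ₚ⁻¹ f 3F))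
    (id , f , (λ _ _ → refl) , f-aut , λ x → sym (^ₚ⁻¹-^ₚ f (x ^ₚ T)))
  where
  distinct : ∀ {x y} → x ≢ y → x ^ₚ T ≢ y ^ₚ T
  distinct x≢y = x≢y ∘ ^ₚ-injective T
  e : Frame
  e = 0F ^ₚ T , 1F ^ₚ T , 2F ^ₚ T
  e-injective : Injective _≡_ _≡_ (linear e)
  e-injective = independent⇒injective (0F ^ₚ T) (1F ^ₚ T) (2F ^ₚ T)
    (distinct λ ()) (distinct λ ()) (distinct λ ()) (noLine 0F 1F λ ())
  f : Perm
  f = element e e-injective
  f-aut : Aut μ f
  f-aut = linear-aut e e-injective

R-surface : Triangles
R-surface = S μ ∪ S (μ ^μ R)

rotations : V × V × V → List (V × V × V)
rotations (x , y , z) = (x , y , z) ∷ (y , z , x) ∷ (z , x , y) ∷ []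

-- One cyclic order of each of the 14 triangles of R-surface, a 7-vertex torus.
orientedTriangles : List (V × V × V)
orientedTriangles =
  (0F , 1F , 3F) ∷ (0F , 2F , 1F) ∷ (0F , 3F , 4F) ∷ (0F , 4F , 6F) ∷ (0F , 5F , 2F) ∷
  (0F , 6F , 5F) ∷ (1F , 2F , 6F) ∷ (1F , 4F , 5F) ∷ (1F , 5F , 3F) ∷ (1F , 6F , 4F) ∷
  (2F , 3F , 6F) ∷ (2F , 4F , 3F) ∷ (2F , 5F , 4F) ∷ (3F , 5F , 6F) ∷ []

positive : V → V → V → Bool
positive x y z = does (Any.any? ((x , y , z) ≟³_) (concatMap rotations orientedTriangles))

opaque
  unfolding R

  R-noLineToLine : NoLineToLine μ (_^ₚ R)
  R-noLineToLine = from-yes (noLineToLine? μ (_^ₚ R))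

  -- Every link is a hexagon, so paths of length 3 suffice.
  R-links : ∀ v a b → a ≢ v → b ≢ v → Is-just (linkPath R-surface (∪S? μ (μ ^μ R)) 3 v a b)
  R-links = from-yes (all? λ v → all? λ a → all? λ b → ¬? (a ≟ v) →-dec ¬? (b ≟ v) →-dec
                      MaybeAny.dec (λ _ → yes tt) (linkPath R-surface (∪S? μ (μ ^μ R)) 3 v a b))

  R-orientation : Orientation R-surface positive
  R-orientation = from-yes (orientation? R-surface (∪S? μ (μ ^μ R)) positive)

R-transversal : Transversal μ R
R-transversal = R-disjoint , disjoint⇒exactlyTwo R-disjoint ,
                λ v a b a≢v b≢v → to-witness (R-links v a b a≢v b≢v)
  where
  R-disjoint : Disjoint (S μ) (S (μ ^μ R))
  R-disjoint = from (disjoint⇔noLineToLine μ R) R-noLineToLine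

opaque
  c : Perm
  c = fromTable (1F ∷ 4F ∷ 6F ∷ 5F ∷ 3F ∷ 2F ∷ 0F ∷ [])

P₀ : Subset
P₀ = Powers c 7

powers? : ∀ g n h → Dec (Powers g n h)
powers? g n h = any? λ k → h ≈ₚ? (g ^ᵖ toℕ k)

opaque
  unfolding c

  c-aut : Aut μ c
  c-aut = from-yes (aut? μ c)

  P₀-∘ₚ : ∀ (j k : Fin 7) → P₀ (c ^ᵖ toℕ j ∘ₚ c ^ᵖ toℕ k)
  P₀-∘ₚ = from-yes (all? λ (j : Fin 7) → all? λ (k : Fin 7) →
                     powers? c 7 (c ^ᵖ toℕ j ∘ₚ c ^ᵖ toℕ k))

  P₀-flip : ∀ (k : Fin 7) → P₀ (flip (c ^ᵖ toℕ k))
  P₀-flip = from-yes (all? λ (k : Fin 7) → powers? c 7 (flip (c ^ᵖ toℕ k)))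

  P₀-distinct : AllPairs.AllPairs (λ g h → ¬ g ≈ₚ h) (map (λ k → c ^ᵖ toℕ k) (allFin 7))
  P₀-distinct =
    from-yes (AllPairs.allPairs? (λ g h → ¬? (g ≈ₚ? h)) (map (λ k → c ^ᵖ toℕ k) (allFin 7)))

P₀-isSubgroup : IsSubgroupOf (Aut μ) P₀
P₀-isSubgroup =
  (λ h (k , h≈cᵏ) → aut-resp (c ^ᵖ toℕ k) h (λ x → sym (h≈cᵏ x))
                      (Subgroup.^ᵖ∈ aut-isSubgroup c (toℕ k) c-aut)) ,
  powers-resp c 7 ,
  (0F , λ _ → refl) ,
  (λ g h (j , g≈cʲ) (k , h≈cᵏ) → powers-resp c 7 (c ^ᵖ toℕ j ∘ₚ c ^ᵖ toℕ k) (g ∘ₚ h)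
     (λ x → sym (∘ₚ-cong g (c ^ᵖ toℕ j) h (c ^ᵖ toℕ k) g≈cʲ h≈cᵏ x)) (P₀-∘ₚ j k)) ,
  (λ g (k , g≈cᵏ) → powers-resp c 7 (flip (c ^ᵖ toℕ k)) (flip g)
     (λ x → sym (flip-cong g (c ^ᵖ toℕ k) g≈cᵏ x)) (P₀-flip k))

P₀-card : HasCard P₀ 7
P₀-card = map (λ k → c ^ᵖ toℕ k) (allFin 7) , refl , P₀-distinct ,
  all-map⁺ (λ k → c ^ᵖ toℕ k) P₀ (allFin 7) (λ k → k , λ _ → refl) ,
  λ h (k , h≈cᵏ) → any-map⁺ (λ k → c ^ᵖ toℕ k) (h ≈ₚ_) (allFin 7) (∈-allFin k) h≈cᵏ

P₀-sylow : IsSylow 7 (Aut μ) P₀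
P₀-sylow = P₀-isSubgroup , 1 , 24 , P₀-card , aut-card , from-no (7 ∣? 24)

-- Inverse-free tests for P₀ (conj g c) and P₀ (conj (flip g) c); inverting g is a search.
conj-c? : ∀ g → Dec (P₀ (conj g c))
conj-c? g = map′ (λ (l , e) → l , from (conj≈⇔ g c (c ^ᵖ toℕ l)) e)
                 (λ (l , e) → l , to (conj≈⇔ g c (c ^ᵖ toℕ l)) e)
  (any? λ l → (c ∘ₚ g) ≈ₚ? (g ∘ₚ c ^ᵖ toℕ l))

conj⁻¹-c? : ∀ g → Dec (P₀ (conj (flip g) c))
conj⁻¹-c? g = map′ (λ (l , e) → l , from (conj⁻¹≈⇔ g c (c ^ᵖ toℕ l)) e)
                   (λ (l , e) → l , to (conj⁻¹≈⇔ g c (c ^ᵖ toℕ l)) e)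
  (any? λ l → (g ∘ₚ c) ≈ₚ? (c ^ᵖ toℕ l ∘ₚ g))

Σᴿ⇔normalizesP₀ : Subset
Σᴿ⇔normalizesP₀ g = Aut μ (conj (flip R) g) ⇔ (P₀ (conj g c) × P₀ (conj (flip g) c))

Σᴿ⇔normalizesP₀-resp : ∀ g h → g ≈ₚ h → Σᴿ⇔normalizesP₀ h → Σᴿ⇔normalizesP₀ g
Σᴿ⇔normalizesP₀-resp g h g≈h h-criterion =
  ⇔.trans (aut-⇔ (conj (flip R) g) (conj (flip R) h) (conj-congʳ (flip R) g h g≈h))
  (⇔.trans h-criterion
    (mk⇔ (λ (hc∈ , h⁻¹c∈) → move h g h≈g hc∈ h⁻¹c∈)
         (λ (gc∈ , g⁻¹c∈) → move g h g≈h gc∈ g⁻¹c∈)))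
  where
  h≈g : h ≈ₚ g
  h≈g x = sym (g≈h x)
  move : ∀ g g' → g ≈ₚ g' → P₀ (conj g c) → P₀ (conj (flip g) c) →
         P₀ (conj g' c) × P₀ (conj (flip g') c)
  move g g' g≈g' gc∈ g⁻¹c∈ =
    powers-resp c 7 (conj g c) (conj g' c) (conj-congˡ g g' c g≈g') gc∈ ,
    powers-resp c 7 (conj (flip g) c) (conj (flip g') c)
                (conj-congˡ (flip g) (flip g') c (flip-cong g g' g≈g')) g⁻¹c∈

opaque
  unfolding R c

  Σᴿ⇔normalizesP₀-listed : All.All Σᴿ⇔normalizesP₀ automorphisms
  Σᴿ⇔normalizesP₀-listed = from-yes
    (All.all? (λ g → aut? μ (conj (flip R) g) ⇔-dec (conj-c? g ×-dec conj⁻¹-c? g)) automorphisms)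

Σ∩Σᴿ⇔normalizer : ∀ g → (Aut μ g × AutConj μ R g) ⇔ Normalizer (Aut μ) P₀ g
Σ∩Σᴿ⇔normalizer g = mk⇔
  (λ (g-aut , g∈Σᴿ) →
     g-aut , from (normalizer-powers⇔ P₀-isSubgroup c∈P₀ g)
                  (to (criterion g-aut) (to (autConj⇔aut μ R g) g∈Σᴿ)))
  (λ (g-aut , normalizes) →
     g-aut , from (autConj⇔aut μ R g)
                  (from (criterion g-aut) (to (normalizer-powers⇔ P₀-isSubgroup c∈P₀ g) normalizes)))
  where
  c∈P₀ : P₀ c
  c∈P₀ = 1F , λ _ → refl
  criterion : Aut μ g → Σᴿ⇔normalizesP₀ g
  criterion =
    hasCard-∀ Σᴿ⇔normalizesP₀ Σᴿ⇔normalizesP₀-resp aut-card Σᴿ⇔normalizesP₀-listed g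

mainTheorem16 :
    (∃ λ T → Transversal μ T) ×
    (∀ T T' → Transversal μ T → Transversal μ T' → SameDoubleCoset μ T T') ×
    (∀ T → Transversal μ T → OrientablyTransversal μ T) ×
    (∀ T → Transversal μ T → ∃ λ P → IsSylow 7 (Aut μ) P ×
       (∀ g → (Aut μ g × AutConj μ T g) ⇔ Normalizer (Aut μ) P g))
mainTheorem16 =
  (R , R-transversal) ,
  (λ T T' T-tr T'-tr →
     sameDoubleCoset-trans {μ} {T} {R} {T'} (sameDoubleCoset-sym {μ} {R} {T} (classify T T-tr))
                                             (classify T' T'-tr)) ,
  (λ T T-tr → let (a , b , a-aut , b-aut , T≈aRb) = classify T T-tr in
     T-tr , orientable-doubleCoset a b R T a-aut b-aut T≈aRb (positive , R-orientation)) ,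
  (λ T T-tr → let (a , b , a-aut , b-aut , T≈aRb) = classify T T-tr in
     P₀ ^ˢ b , isSylow-conj aut-isSubgroup b b-aut P₀-sylow ,
     λ g → ⇔.trans (autConj-doubleCoset a b R T a-aut b-aut T≈aRb g)
           (⇔.trans (Σ∩Σᴿ⇔normalizer (conj (flip b) g))
                    (normalizer-conj aut-isSubgroup (powers-resp c 7) b b-aut g)))
  where
  classify : ∀ T → Transversal μ T → SameDoubleCoset μ R T
  classify T (disjoint , _) = noLineToLine⇒sameDoubleCoset T (to (disjoint⇔noLineToLine μ T) disjoint)
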